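{- Let $G$ be a weak framework for a matroid $M$ and let $C$ be a circuit of $M$. Then either (i) $G[C]$ is a balanced cycle; (ii) $G[C]$ is a connected graph with minimum degree at least two, $|C|=|V(C)|+1$, and $G[C]$ has no balanced cycles; or (iii) $G[C]$ is a collection of pairwise vertex-disjoint non-balanced cycles.
   Context: For a graph $G$ and a vertex $v$, $\mathrm{loops}_G(v)$ denotes the set of loop-edges of $G$ at $v$. Graphs are finite and may have loops and parallel edges; a loop-edge forms a cycle of length one. For a set $X$ of edges, $G[X]$ is the subgraph of $G$ with edge-set $X$ and no isolated vertices, and $V(X)=V(G[X])$. A graph $G$ is a weak framework for a matroid $M$ if (1) $E(G)=E(M)$; (2) $r_M(E(H))\le |V(H)|$ for each component $H$ of $G$; and (3) for each vertex $v$ of $G$, $\mathrm{cl}_M(E(G-v))\subseteq E(G-v)\cup \mathrm{loops}_G(v)$. A cycle $C$ of $G$ is balanced if $E(C)$ is a circuit of $M$. -}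

module Defs where

open import Data.Nat using (ℕ; _+_; _≤_; _<_)
open import Data.Bool using (Bool; _∧_; _∨_; if_then_else_)
open import Data.Fin using (Fin; _≟_)
open import Data.Fin.Subset using (Subset; _∈_; _∉_; _⊆_; _⊂_; _∪_; _∩_; ⁅_⁆; ∣_∣; Nonempty)
open import Data.Fin.Subset.Properties using (_∈?_)
open import Data.Vec using (tabulate)
open import Data.List using (List; map; allFin)
open import Data.Bool.ListAction using (any)
open import Data.Nat.ListAction using (sum)
open import Data.Product using (_×_; _,_; proj₁; proj₂; ∃; Σ-syntax)
open import Data.Sum using (_⊎_)
open import Data.Empty using (⊥)
open import Relation.Nullary using (¬_)
open import Relation.Nullary.Decidable using (⌊_⌋)
open import Relation.Binary.PropositionalEquality using (_≡_)

record Matroid (m : ℕ) : Set where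
  field
    rank       : Subset m → ℕ
    rank-≤-card : ∀ X → rank X ≤ ∣ X ∣
    rank-mono  : ∀ {X Y} → X ⊆ Y → rank X ≤ rank Y
    rank-submod : ∀ X Y → rank (X ∪ Y) + rank (X ∩ Y) ≤ rank X + rank Y

module _ {m : ℕ} (M : Matroid m) where
  open Matroid M

  Independent : Subset m → Set
  Independent X = rank X ≡ ∣ X ∣

  Dependent : Subset m → Set
  Dependent X = rank X < ∣ X ∣

  IsCircuit : Subset m → Set
  IsCircuit C = Dependent C × (∀ D → D ⊂ C → Independent D)

  InClosure : Subset m → Fin m → Set
  InClosure X e = rank (X ∪ ⁅ e ⁆) ≡ rank X

-- Graphs with vertex set Fin n and edge set Fin m; loops and parallel
-- edges allowed.  Each edge has two (unordered) ends; a loop has equal ends.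

record Graph (n m : ℕ) : Set where
  field
    ends : Fin m → Fin n × Fin n

module _ {n m : ℕ} (G : Graph n m) where
  open Graph G

  end₁ end₂ : Fin m → Fin n
  end₁ e = proj₁ (ends e)
  end₂ e = proj₂ (ends e)

  Incident : Fin n → Fin m → Set
  Incident v e = end₁ e ≡ v ⊎ end₂ e ≡ v

  incident? : Fin n → Fin m → Bool
  incident? v e = ⌊ end₁ e ≟ v ⌋ ∨ ⌊ end₂ e ≟ v ⌋

  IsLoopAt : Fin n → Fin m → Set
  IsLoopAt v e = (end₁ e ≡ v) × (end₂ e ≡ v)

  edgesAvoiding : Fin n → Subset m
  edgesAvoiding v = tabulate (λ e → if incident? v e then Bool.false else Bool.true)
    where import Data.Bool as Bool

  InV : Subset m → Fin n → Set
  InV X v = ∃ λ e → e ∈ X × Incident v e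

  VSet : Subset m → Subset n
  VSet X = tabulate (λ v → any (λ e → ⌊ e ∈? X ⌋ ∧ incident? v e) (allFin m))

  data Walk (X : Subset m) : Fin n → Fin n → Set where
    here : ∀ {v} → Walk X v v
    step : ∀ {u w} e → e ∈ X → (end₁ e ≡ u × end₂ e ≡ w) ⊎ (end₂ e ≡ u × end₁ e ≡ w)
           → ∀ {v} → Walk X w v → Walk X u v

  Connected : Subset m → Set
  Connected X = ∀ u v → InV X u → InV X v → Walk X u v

  -- degree of v in G[X] (a loop contributes 2)
  degree : Subset m → Fin n → ℕ
  degree X v = sum (map (λ e → if ⌊ e ∈? X ⌋
                                 then (if ⌊ end₁ e ≟ v ⌋ then 1 else 0)
                                      + (if ⌊ end₂ e ≟ v ⌋ then 1 else 0)
                                 else 0) (allFin m))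

  IsCycle : Subset m → Set
  IsCycle X = Nonempty X × Connected X × (∀ v → InV X v → degree X v ≡ 2)

  IsComponent : Subset n → Set
  IsComponent S = Nonempty S
                × (∀ u v → u ∈ S → v ∈ S → Walk (tabulate (λ _ → Bool.true)) u v)
                × (∀ e → (end₁ e ∈ S → end₂ e ∈ S) × (end₂ e ∈ S → end₁ e ∈ S))
    where import Data.Bool as Bool

  componentEdges : Subset n → Subset m
  componentEdges S = tabulate (λ e → ⌊ end₁ e ∈? S ⌋)

  IsComponentOf : Subset m → Subset m → Set
  IsComponentOf C D = D ⊆ C × Nonempty D × Connected D
                    × (∀ e f → e ∈ D → f ∈ C → f ∉ D → ∀ v → Incident v e → Incident v f → ⊥)

record IsWeakFramework {n m : ℕ} (G : Graph n m) (M : Matroid m) : Set where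
  open Matroid M
  field
    -- (1) E(G) = E(M) holds by construction (both are Fin m)
    -- (2)
    component-rank : ∀ S → IsComponent G S → rank (componentEdges G S) ≤ ∣ S ∣
    vertex-closure : ∀ v e → InClosure M (edgesAvoiding G v) e
                     → e ∈ edgesAvoiding G v ⊎ IsLoopAt G v e

IsBalancedCycle : {n m : ℕ} → Graph n m → Matroid m → Subset m → Set
IsBalancedCycle G M D = IsCycle G D × IsCircuit M D

-- Compare edges with vertices. By axiom (3), no vertex of G[C] has degree one: its edge e
-- would lie in cl(C − e) ⊆ cl(E(G − v)). The handshake lemma then gives |V(C)| ≤ |C|.
-- Axioms (2) and (3) give r(X) ≤ |V(X)| for every edge set X: a vertex set U spanning no
-- crossing edge is a union of components, each bounded by (2), while an edge from U to a
-- new vertex t raises the rank of the edges inside U by (3) at t. Hence |C| = r(C) + 1 ≤ |V(C)| + 1.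
-- If |C| = |V(C)| + 1, a disconnection of G[C] would split C into two independent parts on
-- disjoint vertex sets, of total size at most |V(C)|; and a balanced cycle inside C would be
-- C itself, which is impossible since a cycle has as many edges as vertices.
-- If |C| = |V(C)|, equality in the handshake count makes G[C] 2-regular; its components are
-- cycles, and either G[C] is connected, hence a balanced cycle, or every component is a
-- proper subset of C, hence independent.
module Submission where

open import Defs
open import Data.Nat using (ℕ; zero; suc; _+_; _≤_; _<_; z≤n; s≤s)
open import Data.Nat.Properties hiding (_≟_)
open import Data.Nat.Induction using (<-wellFounded)
import Data.Nat.ListAction as ListAction
open import Data.Bool using (Bool; true; false; T; if_then_else_)
open import Data.Bool.Properties using (T-≡; T-∧; T-∨)
open import Data.Fin using (Fin; zero; suc; _≟_)
import Data.Fin.Properties as Fin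
open import Data.Fin.Subset
  using (Subset; inside; outside; _∈_; _∉_; _⊆_; _⊂_; _∪_; _∩_; _─_; _-_; ⁅_⁆; ∣_∣; Nonempty; ∁; ⊥)
open import Data.Fin.Subset.Properties
open import Data.Vec using ([]; _∷_; tabulate; here; there)
import Data.Vec.Properties as Vec
import Data.List as List
import Data.List.Properties as List
open import Data.List.Relation.Unary.Any using (satisfied)
open import Data.List.Relation.Unary.Any.Properties using (any⁺; any⁻)
open import Data.List.Membership.Propositional using (lose)
open import Data.List.Membership.Propositional.Properties using (∈-allFin)
import Data.Product as Product
open import Data.Product using (_×_; _,_; proj₁; proj₂; ∃; ∃₂)
open import Data.Sum using (_⊎_; inj₁; inj₂; [_,_]; map; map₁; map₂; swap)
open import Data.Empty using (⊥-elim)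
open import Function using (id; _∘_; _on_; _⇔_; mk⇔; Equivalence)
open import Induction.WellFounded using (WellFounded; Acc; acc)
open import Relation.Binary.Construct.On as On using ()
open import Relation.Nullary using (¬_; Dec; yes; no; contradiction)
open import Relation.Nullary.Decidable using (⌊_⌋; _×-dec_; _⊎-dec_; ¬?; decidable-stable; toWitness; fromWitness)
open import Relation.Binary.PropositionalEquality hiding ([_])

open import Algebra.Properties.CommutativeMonoid.Sum +-0-commutativeMonoid
  using (sum-cong-≗; sum-replicate-zero; ∑-distrib-+; ∑-comm)
  renaming (sum to ∑)

𝟙 : ∀ {p} {P : Set p} → Dec P → ℕ
𝟙 d = if ⌊ d ⌋ then 1 else 0

𝟙-cong : ∀ {p q} {P : Set p} {Q : Set q} (dp : Dec P) (dq : Dec Q) → (P → Q) → (Q → P) → 𝟙 dp ≡ 𝟙 dq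
𝟙-cong (yes _) (yes _) _   _   = refl
𝟙-cong (yes p) (no ¬q) p→q _   = contradiction (p→q p) ¬q
𝟙-cong (no ¬p) (yes q) _   q→p = contradiction (q→p q) ¬p
𝟙-cong (no _)  (no _)  _   _   = refl

𝟙-yes : ∀ {p} {P : Set p} (d : Dec P) → P → 𝟙 d ≡ 1
𝟙-yes (yes _) _ = refl
𝟙-yes (no ¬p) p = contradiction p ¬p

𝟙-no : ∀ {p} {P : Set p} (d : Dec P) → ¬ P → 𝟙 d ≡ 0
𝟙-no (yes p) ¬p = contradiction p ¬p
𝟙-no (no _)  _  = refl

m+m≤n+n⇒m≤n : ∀ {m n} → m + m ≤ n + n → m ≤ n
m+m≤n+n⇒m≤n m+m≤n+n = ≮⇒≥ λ n<m → <⇒≱ (+-mono-< n<m n<m) m+m≤n+n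

m+m≡n+n⇒m≡n : ∀ {m n} → m + m ≡ n + n → m ≡ n
m+m≡n+n⇒m≡n eq = ≤-antisym (m+m≤n+n⇒m≤n (≤-reflexive eq)) (m+m≤n+n⇒m≤n (≤-reflexive (sym eq)))

∑-mono-≤ : ∀ {k} {f g : Fin k → ℕ} → (∀ i → f i ≤ g i) → ∑ f ≤ ∑ g
∑-mono-≤ {zero}  f≤g = z≤n
∑-mono-≤ {suc k} f≤g = +-mono-≤ (f≤g zero) (∑-mono-≤ (f≤g ∘ suc))

∑-zero : ∀ {k} {f : Fin k → ℕ} → (∀ i → f i ≡ 0) → ∑ f ≡ 0
∑-zero {k} f≗0 = trans (sum-cong-≗ f≗0) (sum-replicate-zero k)

f[i]≤∑f : ∀ {k} (f : Fin k → ℕ) i → f i ≤ ∑ f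
f[i]≤∑f f zero    = m≤m+n _ _
f[i]≤∑f f (suc i) = ≤-trans (f[i]≤∑f (f ∘ suc) i) (m≤n+m _ _)

f[i]+f[j]≤∑f : ∀ {k} (f : Fin k → ℕ) {i j} → i ≢ j → f i + f j ≤ ∑ f
f[i]+f[j]≤∑f f {zero}  {zero}  i≢j = contradiction refl i≢j
f[i]+f[j]≤∑f f {zero}  {suc j} _   = +-monoʳ-≤ (f zero) (f[i]≤∑f (f ∘ suc) j)
f[i]+f[j]≤∑f f {suc i} {zero}  _   =
  ≤-trans (≤-reflexive (+-comm (f (suc i)) _)) (+-monoʳ-≤ (f zero) (f[i]≤∑f (f ∘ suc) i))
f[i]+f[j]≤∑f f {suc i} {suc j} i≢j =
  ≤-trans (f[i]+f[j]≤∑f (f ∘ suc) (i≢j ∘ cong suc)) (m≤n+m _ _)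

∑-≤⇒≗ : ∀ {k} {f g : Fin k → ℕ} → (∀ i → g i ≤ f i) → ∑ f ≤ ∑ g → ∀ i → f i ≡ g i
∑-≤⇒≗ {suc k} {f} {g} g≤f ∑f≤∑g zero =
  ≤-antisym (+-cancelʳ-≤ _ _ _ (≤-trans ∑f≤∑g (+-monoʳ-≤ (g zero) (∑-mono-≤ (g≤f ∘ suc))))) (g≤f zero)
∑-≤⇒≗ {suc k} {f} {g} g≤f ∑f≤∑g (suc i) =
  ∑-≤⇒≗ (g≤f ∘ suc) (+-cancelˡ-≤ (g zero) _ _ (≤-trans (+-monoˡ-≤ _ (g≤f zero)) ∑f≤∑g)) i

∑-𝟙-≡ : ∀ {k} (i : Fin k) → ∑ (λ j → 𝟙 (i ≟ j)) ≡ 1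
∑-𝟙-≡ {suc k} zero = cong suc (∑-zero {k} λ j → 𝟙-no (zero ≟ suc j) λ ())
∑-𝟙-≡ (suc i)      = trans (sum-cong-≗ λ j → 𝟙-cong (suc i ≟ suc j) (i ≟ j) Fin.suc-injective (cong suc))
                      (∑-𝟙-≡ i)

∣p∣≡∑𝟙 : ∀ {k} (p : Subset k) → ∣ p ∣ ≡ ∑ (λ x → 𝟙 (x ∈? p))
∣p∣≡∑𝟙-∷ : ∀ {k} b (p : Subset k) → ∣ p ∣ ≡ ∑ (λ x → 𝟙 (suc x ∈? b ∷ p))

∣p∣≡∑𝟙 []            = refl
∣p∣≡∑𝟙 (inside  ∷ p) = cong suc (∣p∣≡∑𝟙-∷ inside p)
∣p∣≡∑𝟙 (outside ∷ p) = ∣p∣≡∑𝟙-∷ outside p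

∣p∣≡∑𝟙-∷ b p = trans (∣p∣≡∑𝟙 p) (sum-cong-≗ λ x → 𝟙-cong (x ∈? p) (suc x ∈? b ∷ p) there drop-there)

∣p∣+∣q∣≡∑𝟙 : ∀ {k} (p q : Subset k) → ∣ p ∣ + ∣ q ∣ ≡ ∑ (λ x → 𝟙 (x ∈? p) + 𝟙 (x ∈? q))
∣p∣+∣q∣≡∑𝟙 p q = trans (cong₂ _+_ (∣p∣≡∑𝟙 p) (∣p∣≡∑𝟙 q)) (sym (∑-distrib-+ (λ x → 𝟙 (x ∈? p)) (λ x → 𝟙 (x ∈? q))))

∣p∪q∣≤∣p∣+∣q∣ : ∀ {k} (p q : Subset k) → ∣ p ∪ q ∣ ≤ ∣ p ∣ + ∣ q ∣
∣p∪q∣≤∣p∣+∣q∣ p q = begin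
  ∣ p ∪ q ∣                                 ≡⟨ ∣p∣≡∑𝟙 (p ∪ q) ⟩
  ∑ (λ x → 𝟙 (x ∈? p ∪ q))                  ≤⟨ ∑-mono-≤ (λ x → 𝟙-∪ (x ∈? p ∪ q) (x ∈? p) (x ∈? q) (x∈p∪q⁻ p q)) ⟩
  ∑ (λ x → 𝟙 (x ∈? p) + 𝟙 (x ∈? q))         ≡⟨ ∣p∣+∣q∣≡∑𝟙 p q ⟨
  ∣ p ∣ + ∣ q ∣                             ∎
  where
  open ≤-Reasoning
  𝟙-∪ : ∀ {R P Q : Set} (dr : Dec R) (dp : Dec P) (dq : Dec Q) → (R → P ⊎ Q) → 𝟙 dr ≤ 𝟙 dp + 𝟙 dq
  𝟙-∪ (no _)  _       _       _ = z≤n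
  𝟙-∪ (yes r) (yes _) _       _ = s≤s z≤n
  𝟙-∪ (yes r) (no _)  (yes _) _ = s≤s z≤n
  𝟙-∪ (yes r) (no ¬p) (no ¬q) f = contradiction (f r) [ ¬p , ¬q ]

∣p∣+∣q∣≤∣r∣ : ∀ {k} {p q r : Subset k} → p ⊆ r → q ⊆ r → (∀ {x} → x ∈ p → x ∉ q) → ∣ p ∣ + ∣ q ∣ ≤ ∣ r ∣
∣p∣+∣q∣≤∣r∣ {p = p} {q} {r} p⊆r q⊆r disjoint = begin
  ∣ p ∣ + ∣ q ∣                       ≡⟨ ∣p∣+∣q∣≡∑𝟙 p q ⟩
  ∑ (λ x → 𝟙 (x ∈? p) + 𝟙 (x ∈? q))   ≤⟨ ∑-mono-≤ (λ x → 𝟙-disjoint (x ∈? p) (x ∈? q) (x ∈? r)) ⟩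
  ∑ (λ x → 𝟙 (x ∈? r))                ≡⟨ ∣p∣≡∑𝟙 r ⟨
  ∣ r ∣                               ∎
  where
  open ≤-Reasoning
  𝟙-disjoint : ∀ {x} (dp : Dec (x ∈ p)) (dq : Dec (x ∈ q)) (dr : Dec (x ∈ r)) → 𝟙 dp + 𝟙 dq ≤ 𝟙 dr
  𝟙-disjoint (yes x∈p) (yes x∈q) _       = contradiction x∈q (disjoint x∈p)
  𝟙-disjoint (yes x∈p) (no _)    dr      = ≤-reflexive (sym (𝟙-yes dr (p⊆r x∈p)))
  𝟙-disjoint (no _)    (yes x∈q) dr      = ≤-reflexive (sym (𝟙-yes dr (q⊆r x∈q)))
  𝟙-disjoint (no _)    (no _)    _       = z≤n

∈-tabulate⁺ : ∀ {k} (f : Fin k → Bool) {x} → T (f x) → x ∈ tabulate f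
∈-tabulate⁺ f {x} fx = Vec.lookup⇒[]= x (tabulate f) (trans (Vec.lookup∘tabulate f x) (Equivalence.to T-≡ fx))

∈-tabulate⁻ : ∀ {k} (f : Fin k → Bool) {x} → x ∈ tabulate f → T (f x)
∈-tabulate⁻ f {x} x∈ = Equivalence.from T-≡ (trans (sym (Vec.lookup∘tabulate f x)) (Vec.[]=⇒lookup x∈))

select : ∀ {k ℓ} {P : Fin k → Set ℓ} → (∀ x → Dec (P x)) → Subset k
select P? = tabulate (λ x → ⌊ P? x ⌋)

∈-select⁺ : ∀ {k ℓ} {P : Fin k → Set ℓ} (P? : ∀ x → Dec (P x)) {x} → P x → x ∈ select P?
∈-select⁺ P? px = ∈-tabulate⁺ _ (fromWitness px)

∈-select⁻ : ∀ {k ℓ} {P : Fin k → Set ℓ} (P? : ∀ x → Dec (P x)) {x} → x ∈ select P? → P x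
∈-select⁻ P? x∈ = toWitness (∈-tabulate⁻ _ x∈)

⊆-or-∉ : ∀ {k} (p q : Subset k) → p ⊆ q ⊎ ∃ λ x → x ∈ p × x ∉ q
⊆-or-∉ p q with Fin.any? (λ x → x ∈? p ×-dec ¬? (x ∈? q))
... | yes witness = inj₂ witness
... | no ∄witness = inj₁ λ {x} x∈p → decidable-stable (x ∈? q) (λ x∉q → ∄witness (x , x∈p , x∉q))

⊆⇒⊂⊎⊇ : ∀ {k} {p q : Subset k} → p ⊆ q → p ⊂ q ⊎ q ⊆ p
⊆⇒⊂⊎⊇ {p = p} {q} p⊆q = map₁ (λ witness → p⊆q , witness) (swap (⊆-or-∉ q p))

x∈p-y⇒x≢y : ∀ {k} {p : Subset k} {x y} → x ∈ p - y → x ≢ y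
x∈p-y⇒x≢y {x = x} x∈p-y refl = x∉p─q (x∈⁅x⁆ x) x∈p-y
  where
  x∉p─q : ∀ {k} {p q : Subset k} {x} → x ∈ q → x ∉ p ─ q
  x∉p─q {p = _ ∷ p} {inside ∷ q} here        ()
  x∉p─q {p = _ ∷ p} {_      ∷ q} (there x∈q) (there x∈p─q) = x∉p─q x∈q x∈p─q

p⊆⁅x⁆∪p-x : ∀ {k} (p : Subset k) x → p ⊆ ⁅ x ⁆ ∪ (p - x)
p⊆⁅x⁆∪p-x p x {y} y∈p with y ≟ x
... | yes refl = p⊆p∪q (p - x) (x∈⁅x⁆ x)
... | no y≢x   = q⊆p∪q ⁅ x ⁆ (p - x) (x∈p∧x≢y⇒x∈p-y y∈p y≢x)

∣p∣≤1+∣p-x∣ : ∀ {k} (p : Subset k) x → ∣ p ∣ ≤ suc ∣ p - x ∣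
∣p∣≤1+∣p-x∣ p x = begin
  ∣ p ∣                   ≤⟨ p⊆q⇒∣p∣≤∣q∣ (p⊆⁅x⁆∪p-x p x) ⟩
  ∣ ⁅ x ⁆ ∪ (p - x) ∣     ≤⟨ ∣p∪q∣≤∣p∣+∣q∣ ⁅ x ⁆ (p - x) ⟩
  ∣ ⁅ x ⁆ ∣ + ∣ p - x ∣   ≡⟨ cong (_+ ∣ p - x ∣) (∣⁅x⁆∣≡1 x) ⟩
  suc ∣ p - x ∣           ∎
  where open ≤-Reasoning

_⊃ᶜ_ : ∀ {k} → Subset k → Subset k → Set
q ⊃ᶜ p = ∣ ∁ q ∣ < ∣ ∁ p ∣

⊃ᶜ-wellFounded : ∀ {k} → WellFounded (_⊃ᶜ_ {k})
⊃ᶜ-wellFounded = On.wellFounded (∣_∣ ∘ ∁) <-wellFounded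

p∪⁅x⁆⊃ᶜp : ∀ {k} {p : Subset k} {x} → x ∉ p → (p ∪ ⁅ x ⁆) ⊃ᶜ p
p∪⁅x⁆⊃ᶜp {p = p} {x} x∉p =
  p⊂q⇒∣p∣<∣q∣ (p⊂q⇒∁p⊃∁q (p⊆p∪q ⁅ x ⁆ , x , q⊆p∪q p ⁅ x ⁆ (x∈⁅x⁆ x) , x∉p))

module MatroidProperties {m} (M : Matroid m) where
  open Matroid M

  InClosure-mono : ∀ {X Y e} → X ⊆ Y → InClosure M X e → InClosure M Y e
  InClosure-mono {X} {Y} {e} X⊆Y e∈clX = ≤-antisym rank[Y∪e]≤rank[Y] (rank-mono (p⊆p∪q ⁅ e ⁆))
    where
    X⊆Y∩[X∪e] : X ⊆ Y ∩ (X ∪ ⁅ e ⁆)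
    X⊆Y∩[X∪e] x∈X = x∈p∩q⁺ (X⊆Y x∈X , p⊆p∪q ⁅ e ⁆ x∈X)
    Y∪e⊆Y∪[X∪e] : Y ∪ ⁅ e ⁆ ⊆ Y ∪ (X ∪ ⁅ e ⁆)
    Y∪e⊆Y∪[X∪e] x∈ = [ p⊆p∪q _ , q⊆p∪q Y _ ∘ q⊆p∪q X ⁅ e ⁆ ] (x∈p∪q⁻ Y ⁅ e ⁆ x∈)
    rank[Y∪e]≤rank[Y] : rank (Y ∪ ⁅ e ⁆) ≤ rank Y
    rank[Y∪e]≤rank[Y] = +-cancelʳ-≤ (rank X) _ _ (begin
      rank (Y ∪ ⁅ e ⁆) + rank X
        ≤⟨ +-mono-≤ (rank-mono Y∪e⊆Y∪[X∪e]) (rank-mono X⊆Y∩[X∪e]) ⟩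
      rank (Y ∪ (X ∪ ⁅ e ⁆)) + rank (Y ∩ (X ∪ ⁅ e ⁆))
        ≤⟨ rank-submod Y (X ∪ ⁅ e ⁆) ⟩
      rank Y + rank (X ∪ ⁅ e ⁆)
        ≡⟨ cong (rank Y +_) e∈clX ⟩
      rank Y + rank X ∎)
      where open ≤-Reasoning

  rank-subadditive : ∀ X Y → rank (X ∪ Y) ≤ rank X + rank Y
  rank-subadditive X Y = ≤-trans (m≤m+n _ _) (rank-submod X Y)

  ∉closure⇒rank-increases : ∀ {X e} → ¬ InClosure M X e → suc (rank X) ≤ rank (X ∪ ⁅ e ⁆)
  ∉closure⇒rank-increases e∉clX = ≤∧≢⇒< (rank-mono (p⊆p∪q _)) (e∉clX ∘ sym)

  module _ {C : Subset m} (circuit : IsCircuit M C) where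

    circuit-nonempty : Nonempty C
    circuit-nonempty with nonempty? C
    ... | yes C≢∅ = C≢∅
    ... | no  C≡∅ = contradiction (proj₁ circuit) (≤⇒≯ (begin
      ∣ C ∣          ≡⟨ cong ∣_∣ (Empty-unique C≡∅) ⟩
      ∣ ⊥ {n = m} ∣  ≡⟨ ∣⊥∣≡0 m ⟩
      0              ≤⟨ z≤n ⟩
      rank C         ∎))
      where open ≤-Reasoning

    ∣C∣≤1+rank[C-e] : ∀ {e} → e ∈ C → ∣ C ∣ ≤ suc (rank (C - e))
    ∣C∣≤1+rank[C-e] {e} e∈C = begin
      ∣ C ∣              ≤⟨ ∣p∣≤1+∣p-x∣ C e ⟩
      suc ∣ C - e ∣      ≡⟨ cong suc (proj₂ circuit (C - e) (x∈p⇒p-x⊂p e∈C)) ⟨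
      suc (rank (C - e)) ∎
      where open ≤-Reasoning

    ∣C∣≤1+rank[C] : ∣ C ∣ ≤ suc (rank C)
    ∣C∣≤1+rank[C] = ≤-trans (∣C∣≤1+rank[C-e] (proj₂ circuit-nonempty)) (s≤s (rank-mono (p─q⊆p C _)))

    circuit-element∈closure : ∀ {e} → e ∈ C → InClosure M (C - e) e
    circuit-element∈closure {e} e∈C = ≤-antisym
      (begin
        rank ((C - e) ∪ ⁅ e ⁆)  ≤⟨ rank-mono [C-e]∪e⊆C ⟩
        rank C                  ≤⟨ m<1+n⇒m≤n (<-≤-trans (proj₁ circuit) (∣C∣≤1+rank[C-e] e∈C)) ⟩
        rank (C - e)            ∎)
      (rank-mono (p⊆p∪q _))
      where
      open ≤-Reasoning
      [C-e]∪e⊆C : (C - e) ∪ ⁅ e ⁆ ⊆ C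
      [C-e]∪e⊆C x∈ with x∈p∪q⁻ (C - e) ⁅ e ⁆ x∈
      ... | inj₁ x∈C-e = p─q⊆p C _ x∈C-e
      ... | inj₂ x∈⁅e⁆ = subst (_∈ C) (sym (x∈⁅y⁆⇒x≡y e x∈⁅e⁆)) e∈C

    dependent-⊆-circuit⇒⊇ : ∀ {D} → D ⊆ C → Dependent M D → C ⊆ D
    dependent-⊆-circuit⇒⊇ D⊆C D-dependent with ⊆⇒⊂⊎⊇ D⊆C
    ... | inj₁ D⊂C = contradiction (proj₂ circuit _ D⊂C) (<⇒≢ D-dependent)
    ... | inj₂ C⊆D = C⊆D

module GraphProperties {n m} (G : Graph n m) where

  Joins : Fin m → Fin n → Fin n → Set
  Joins e x y = (end₁ G e ≡ x × end₂ G e ≡ y) ⊎ (end₂ G e ≡ x × end₁ G e ≡ y)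

  Joins-sym : ∀ {e x y} → Joins e x y → Joins e y x
  Joins-sym (inj₁ (e₁≡x , e₂≡y)) = inj₂ (e₂≡y , e₁≡x)
  Joins-sym (inj₂ (e₂≡x , e₁≡y)) = inj₁ (e₁≡y , e₂≡x)

  Joins⇒Incident : ∀ {e x y} → Joins e x y → Incident G x e
  Joins⇒Incident (inj₁ (e₁≡x , _)) = inj₁ e₁≡x
  Joins⇒Incident (inj₂ (e₂≡x , _)) = inj₂ e₂≡x

  Joins⇒ends∈ : ∀ {e x y S} → Joins e x y → x ∈ S → y ∈ S → end₁ G e ∈ S × end₂ G e ∈ S
  Joins⇒ends∈ (inj₁ (refl , refl)) x∈S y∈S = x∈S , y∈S
  Joins⇒ends∈ (inj₂ (refl , refl)) x∈S y∈S = y∈S , x∈S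

  Joins-loop : ∀ {e x y} → Joins e x y → IsLoopAt G y e → x ≡ y
  Joins-loop (inj₁ (refl , _)) (e₁≡y , _) = e₁≡y
  Joins-loop (inj₂ (refl , _)) (_ , e₂≡y) = e₂≡y

  _++ʷ_ : ∀ {X u w v} → Walk G X u w → Walk G X w v → Walk G X u v
  here               ++ʷ q = q
  step e e∈X joins p ++ʷ q = step e e∈X joins (p ++ʷ q)

  reverseʷ : ∀ {X u v} → Walk G X u v → Walk G X v u
  reverseʷ here               = here
  reverseʷ (step e e∈X joins p) = reverseʷ p ++ʷ step e e∈X (Joins-sym joins) here

  Closed : Subset m → Subset n → Set
  Closed X S = ∀ {e x y} → e ∈ X → Joins e x y → x ∈ S → y ∈ S

  Crossing : Subset m → Subset n → Set
  Crossing X S = ∃ λ e → ∃₂ λ x y → e ∈ X × Joins e x y × x ∈ S × y ∉ S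

  walk-stays : ∀ {X S u v} → Closed X S → u ∈ S → Walk G X u v → v ∈ S
  walk-stays closed u∈S here                 = u∈S
  walk-stays closed u∈S (step e e∈X joins p) = walk-stays closed (closed e∈X joins u∈S) p

  end₁∈closed : ∀ {X R e v} → Closed X R → e ∈ X → Incident G v e → v ∈ R → end₁ G e ∈ R
  end₁∈closed closed e∈X (inj₁ refl) v∈R = v∈R
  end₁∈closed closed e∈X (inj₂ refl) v∈R = closed e∈X (inj₂ (refl , refl)) v∈R

  end₁∈closed⁻ : ∀ {X R e v} → Closed X R → e ∈ X → Incident G v e → end₁ G e ∈ R → v ∈ R
  end₁∈closed⁻ closed e∈X (inj₁ refl) e₁∈R = e₁∈R
  end₁∈closed⁻ closed e∈X (inj₂ refl) e₁∈R = closed e∈X (inj₁ (refl , refl)) e₁∈R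

  closed-or-crossing : ∀ X S → Closed X S ⊎ Crossing X S
  closed-or-crossing X S with Fin.any? (λ e → e ∈? X ×-dec leaves? e)
    where
    leaves? : ∀ e → Dec ((end₁ G e ∈ S × end₂ G e ∉ S) ⊎ (end₂ G e ∈ S × end₁ G e ∉ S))
    leaves? e = (end₁ G e ∈? S ×-dec ¬? (end₂ G e ∈? S)) ⊎-dec (end₂ G e ∈? S ×-dec ¬? (end₁ G e ∈? S))
  ... | yes (e , e∈X , inj₁ (x∈S , y∉S)) = inj₂ (e , _ , _ , e∈X , inj₁ (refl , refl) , x∈S , y∉S)
  ... | yes (e , e∈X , inj₂ (x∈S , y∉S)) = inj₂ (e , _ , _ , e∈X , inj₂ (refl , refl) , x∈S , y∉S)
  ... | no ∄crossing = inj₁ λ {_} {_} {y} e∈X joins x∈S →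
    decidable-stable (y ∈? S) λ y∉S → ∄crossing (_ , e∈X , leaves joins x∈S y∉S)
    where
    leaves : ∀ {e x y} → Joins e x y → x ∈ S → y ∉ S
           → (end₁ G e ∈ S × end₂ G e ∉ S) ⊎ (end₂ G e ∈ S × end₁ G e ∉ S)
    leaves (inj₁ (refl , refl)) x∈S y∉S = inj₁ (x∈S , y∉S)
    leaves (inj₂ (refl , refl)) x∈S y∉S = inj₂ (x∈S , y∉S)

  record ReachClosure (X : Subset m) (u : Fin n) : Set where
    field
      reached : Subset n
      start∈  : u ∈ reached
      walk-to : ∀ {w} → w ∈ reached → Walk G X u w
      closed  : Closed X reached

  reachClosure : ∀ X u → ReachClosure X u
  reachClosure X u = grow ⁅ u ⁆ (⊃ᶜ-wellFounded _) (x∈⁅x⁆ u) walk-to-u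
    where
    walk-to-u : ∀ {w} → w ∈ ⁅ u ⁆ → Walk G X u w
    walk-to-u w∈⁅u⁆ with x∈⁅y⁆⇒x≡y u w∈⁅u⁆
    ... | refl = here
    grow : ∀ S → Acc _⊃ᶜ_ S → u ∈ S → (∀ {w} → w ∈ S → Walk G X u w) → ReachClosure X u
    grow S (acc larger) u∈S walks with closed-or-crossing X S
    ... | inj₁ closed = record { reached = S ; start∈ = u∈S ; walk-to = walks ; closed = closed }
    ... | inj₂ (e , x , y , e∈X , joins , x∈S , y∉S) =
      grow (S ∪ ⁅ y ⁆) (larger (p∪⁅x⁆⊃ᶜp y∉S)) (p⊆p∪q _ u∈S) walks′
      where
      walks′ : ∀ {w} → w ∈ S ∪ ⁅ y ⁆ → Walk G X u w
      walks′ w∈ with x∈p∪q⁻ S ⁅ y ⁆ w∈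
      ... | inj₁ w∈S   = walks w∈S
      ... | inj₂ w∈⁅y⁆ with x∈⁅y⁆⇒x≡y y w∈⁅y⁆
      ...   | refl = walks x∈S ++ʷ step e e∈X joins here

  -- Written as in IsComponent rather than as Data.Fin.Subset.⊤, so that the two agree definitionally.
  allEdges : Subset m
  allEdges = tabulate (λ _ → true)

  reachClosure-isComponent : ∀ {u} (R : ReachClosure allEdges u) → IsComponent G (ReachClosure.reached R)
  reachClosure-isComponent {u} R =
    (u , start∈) ,
    (λ x y x∈R y∈R → reverseʷ (walk-to x∈R) ++ʷ walk-to y∈R) ,
    (λ e → closed (∈-tabulate⁺ _ _) (inj₁ (refl , refl)) , closed (∈-tabulate⁺ _ _) (inj₂ (refl , refl)))
    where open ReachClosure R

  T-incident? : ∀ {v e} → T (incident? G v e) ⇔ Incident G v e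
  T-incident? {v} {e} = mk⇔
    (map toWitness toWitness ∘ Equivalence.to (T-∨ {⌊ end₁ G e ≟ v ⌋} {⌊ end₂ G e ≟ v ⌋}))
    (Equivalence.from (T-∨ {⌊ end₁ G e ≟ v ⌋} {⌊ end₂ G e ≟ v ⌋}) ∘ map fromWitness fromWitness)

  ∈edgesAvoiding⁺ : ∀ {v e} → ¬ Incident G v e → e ∈ edgesAvoiding G v
  ∈edgesAvoiding⁺ {v} {e} ¬incident = ∈-tabulate⁺ _ (T-if-not (¬incident ∘ Equivalence.to T-incident?))
    where
    T-if-not : ∀ {b} → ¬ T b → T (if b then false else true)
    T-if-not {true}  ¬t = ¬t _
    T-if-not {false} _  = _

  ∈edgesAvoiding⁻ : ∀ {v e} → e ∈ edgesAvoiding G v → ¬ Incident G v e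
  ∈edgesAvoiding⁻ {v} {e} e∈ = T-if-not⁻ (∈-tabulate⁻ _ e∈) ∘ Equivalence.from T-incident?
    where
    T-if-not⁻ : ∀ {b} → T (if b then false else true) → ¬ T b
    T-if-not⁻ {true}  ()
    T-if-not⁻ {false} _ ()

  ∈VSet⁺ : ∀ {X v} → InV G X v → v ∈ VSet G X
  ∈VSet⁺ (e , e∈X , incident) = ∈-tabulate⁺ _
    (any⁺ _ (lose (∈-allFin e) (Equivalence.from T-∧ (fromWitness e∈X , Equivalence.from T-incident? incident))))

  ∈VSet⁻ : ∀ {X v} → v ∈ VSet G X → InV G X v
  ∈VSet⁻ {X} {v} v∈ with satisfied (any⁻ _ (List.allFin m) (∈-tabulate⁻ _ v∈))
  ... | e , e-witness with Equivalence.to T-∧ e-witness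
  ...   | e∈X , incident = e , toWitness e∈X , Equivalence.to T-incident? incident

  InV-mono : ∀ {D C v} → D ⊆ C → InV G D v → InV G C v
  InV-mono D⊆C (e , e∈D , incident) = e , D⊆C e∈D , incident

  connected⊎proper-components : ∀ {X} → Nonempty X → Connected G X ⊎ (∀ D → IsComponentOf G X D → ¬ X ⊆ D)
  connected⊎proper-components {X} (e , e∈X) = from-reach (⊆-or-∉ (VSet G X) reached)
    where
    open ReachClosure (reachClosure X (end₁ G e))
    from-reach : VSet G X ⊆ reached ⊎ (∃ λ v → v ∈ VSet G X × v ∉ reached)
               → Connected G X ⊎ (∀ D → IsComponentOf G X D → ¬ X ⊆ D)
    from-reach (inj₁ V⊆R) = inj₁ λ a b a∈V b∈V →
      reverseʷ (walk-to (V⊆R (∈VSet⁺ a∈V))) ++ʷ walk-to (V⊆R (∈VSet⁺ b∈V))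
    from-reach (inj₂ (v , v∈V , v∉R)) = inj₂ λ D (D⊆X , _ , D-connected , _) X⊆D →
      v∉R (walk-stays (closed ∘ D⊆X) start∈
             (D-connected _ _ (InV-mono X⊆D (e , e∈X , inj₁ refl)) (InV-mono X⊆D (∈VSet⁻ v∈V))))

  incidence : Subset m → Fin n → Fin m → ℕ
  incidence X v e = if ⌊ e ∈? X ⌋ then 𝟙 (end₁ G e ≟ v) + 𝟙 (end₂ G e ≟ v) else 0

  degree≡∑incidence : ∀ X v → degree G X v ≡ ∑ (incidence X v)
  degree≡∑incidence X v = trans (cong ListAction.sum (List.map-tabulate id (incidence X v)))
                                (sum-tabulate (incidence X v))
    where
    sum-tabulate : ∀ {k} (f : Fin k → ℕ) → ListAction.sum (List.tabulate f) ≡ ∑ f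
    sum-tabulate {zero}  f = refl
    sum-tabulate {suc k} f = cong (f zero +_) (sum-tabulate (f ∘ suc))

  incidence-∈ : ∀ {X v e} → e ∈ X → incidence X v e ≡ 𝟙 (end₁ G e ≟ v) + 𝟙 (end₂ G e ≟ v)
  incidence-∈ {X} {v} {e} e∈X with e ∈? X
  ... | yes _   = refl
  ... | no e∉X  = contradiction e∈X e∉X

  incidence≡0 : ∀ {X v e} → ¬ (e ∈ X × Incident G v e) → incidence X v e ≡ 0
  incidence≡0 {X} {v} {e} ¬incident with e ∈? X
  ... | no  _   = refl
  ... | yes e∈X = cong₂ _+_ (𝟙-no (end₁ G e ≟ v) (λ e₁≡v → ¬incident (e∈X , inj₁ e₁≡v)))
                            (𝟙-no (end₂ G e ≟ v) (λ e₂≡v → ¬incident (e∈X , inj₂ e₂≡v)))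

  1≤incidence : ∀ {X v e} → e ∈ X → Incident G v e → 1 ≤ incidence X v e
  1≤incidence {X} {v} {e} e∈X incident with e ∈? X
  ... | no e∉X = contradiction e∈X e∉X
  ... | yes _ with incident
  ...   | inj₁ e₁≡v = ≤-trans (≤-reflexive (sym (𝟙-yes (end₁ G e ≟ v) e₁≡v))) (m≤m+n _ _)
  ...   | inj₂ e₂≡v = ≤-trans (≤-reflexive (sym (𝟙-yes (end₂ G e ≟ v) e₂≡v))) (m≤n+m _ _)

  2≤incidence : ∀ {X v e} → e ∈ X → IsLoopAt G v e → 2 ≤ incidence X v e
  2≤incidence {X} {v} {e} e∈X (e₁≡v , e₂≡v) with e ∈? X
  ... | no e∉X = contradiction e∈X e∉X
  ... | yes _  = ≤-reflexive (sym (cong₂ _+_ (𝟙-yes (end₁ G e ≟ v) e₁≡v) (𝟙-yes (end₂ G e ≟ v) e₂≡v)))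

  degree≡0 : ∀ {X v} → ¬ InV G X v → degree G X v ≡ 0
  degree≡0 {X} {v} v∉V = trans (degree≡∑incidence X v)
    (∑-zero λ e → incidence≡0 λ (e∈X , incident) → v∉V (e , e∈X , incident))

  loop⇒2≤degree : ∀ {X v e} → e ∈ X → IsLoopAt G v e → 2 ≤ degree G X v
  loop⇒2≤degree {X} {v} {e} e∈X loop = begin
    2                      ≤⟨ 2≤incidence e∈X loop ⟩
    incidence X v e        ≤⟨ f[i]≤∑f (incidence X v) e ⟩
    ∑ (incidence X v)      ≡⟨ degree≡∑incidence X v ⟨
    degree G X v           ∎
    where open ≤-Reasoning

  two-incident⇒2≤degree : ∀ {X v e f} → e ∈ X → f ∈ X → e ≢ f
                        → Incident G v e → Incident G v f → 2 ≤ degree G X v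
  two-incident⇒2≤degree {X} {v} {e} {f} e∈X f∈X e≢f e-incident f-incident = begin
    1 + 1                                ≤⟨ +-mono-≤ (1≤incidence e∈X e-incident) (1≤incidence f∈X f-incident) ⟩
    incidence X v e + incidence X v f    ≤⟨ f[i]+f[j]≤∑f (incidence X v) e≢f ⟩
    ∑ (incidence X v)                    ≡⟨ degree≡∑incidence X v ⟨
    degree G X v                         ∎
    where open ≤-Reasoning

  degree-agree : ∀ {D C v} → D ⊆ C → (∀ {f} → f ∈ C → f ∉ D → ¬ Incident G v f)
               → degree G D v ≡ degree G C v
  degree-agree {D} {C} {v} D⊆C only-D-at-v = begin
    degree G D v        ≡⟨ degree≡∑incidence D v ⟩
    ∑ (incidence D v)   ≡⟨ sum-cong-≗ agree ⟩
    ∑ (incidence C v)   ≡⟨ degree≡∑incidence C v ⟨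
    degree G C v        ∎
    where
    open ≡-Reasoning
    agree : ∀ f → incidence D v f ≡ incidence C v f
    agree f with f ∈? D
    ... | yes f∈D = sym (incidence-∈ (D⊆C f∈D))
    ... | no f∉D  = sym (incidence≡0 λ (f∈C , incident) → only-D-at-v f∈C f∉D incident)

  ∑-incidence : ∀ X e → ∑ (λ v → incidence X v e) ≡ 𝟙 (e ∈? X) + 𝟙 (e ∈? X)
  ∑-incidence X e with e ∈? X
  ... | no _  = ∑-zero {n} λ _ → refl
  ... | yes _ = trans (∑-distrib-+ (λ v → 𝟙 (end₁ G e ≟ v)) (λ v → 𝟙 (end₂ G e ≟ v)))
                      (cong₂ _+_ (∑-𝟙-≡ (end₁ G e)) (∑-𝟙-≡ (end₂ G e)))

  handshake : ∀ X → ∑ (degree G X) ≡ ∣ X ∣ + ∣ X ∣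
  handshake X = begin
    ∑ (degree G X)                              ≡⟨ sum-cong-≗ (degree≡∑incidence X) ⟩
    ∑ (λ v → ∑ (λ e → incidence X v e))         ≡⟨ ∑-comm (incidence X) ⟩
    ∑ (λ e → ∑ (λ v → incidence X v e))         ≡⟨ sum-cong-≗ (∑-incidence X) ⟩
    ∑ (λ e → 𝟙 (e ∈? X) + 𝟙 (e ∈? X))           ≡⟨ ∣p∣+∣q∣≡∑𝟙 X X ⟨
    ∣ X ∣ + ∣ X ∣                               ∎
    where open ≡-Reasoning

  module _ (X : Subset m) where

    private
      V : Subset n
      V = VSet G X

      twice-𝟙 : Fin n → ℕ
      twice-𝟙 v = 𝟙 (v ∈? V) + 𝟙 (v ∈? V)

      twice-𝟙≤degree : (∀ v → InV G X v → 2 ≤ degree G X v) → ∀ v → twice-𝟙 v ≤ degree G X v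
      twice-𝟙≤degree min-degree v with v ∈? V
      ... | yes v∈V = min-degree v (∈VSet⁻ v∈V)
      ... | no  _   = z≤n

    ∣VSet∣≤∣X∣ : (∀ v → InV G X v → 2 ≤ degree G X v) → ∣ V ∣ ≤ ∣ X ∣
    ∣VSet∣≤∣X∣ min-degree = m+m≤n+n⇒m≤n (begin
      ∣ V ∣ + ∣ V ∣      ≡⟨ ∣p∣+∣q∣≡∑𝟙 V V ⟩
      ∑ twice-𝟙          ≤⟨ ∑-mono-≤ (twice-𝟙≤degree min-degree) ⟩
      ∑ (degree G X)     ≡⟨ handshake X ⟩
      ∣ X ∣ + ∣ X ∣      ∎)
      where open ≤-Reasoning

    2-regular⇒∣X∣≡∣VSet∣ : (∀ v → InV G X v → degree G X v ≡ 2) → ∣ X ∣ ≡ ∣ V ∣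
    2-regular⇒∣X∣≡∣VSet∣ 2-regular = m+m≡n+n⇒m≡n (begin
      ∣ X ∣ + ∣ X ∣      ≡⟨ handshake X ⟨
      ∑ (degree G X)     ≡⟨ sum-cong-≗ degree≡twice-𝟙 ⟩
      ∑ twice-𝟙          ≡⟨ ∣p∣+∣q∣≡∑𝟙 V V ⟨
      ∣ V ∣ + ∣ V ∣      ∎)
      where
      open ≡-Reasoning
      degree≡twice-𝟙 : ∀ v → degree G X v ≡ twice-𝟙 v
      degree≡twice-𝟙 v with v ∈? V
      ... | yes v∈V = 2-regular v (∈VSet⁻ v∈V)
      ... | no  v∉V = degree≡0 (v∉V ∘ ∈VSet⁺)

    -- Equality in the handshake bound of ∣VSet∣≤∣X∣ forces equality at every vertex.
    ∣X∣≡∣VSet∣⇒2-regular : (∀ v → InV G X v → 2 ≤ degree G X v) → ∣ X ∣ ≡ ∣ V ∣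
                         → ∀ v → InV G X v → degree G X v ≡ 2
    ∣X∣≡∣VSet∣⇒2-regular min-degree ∣X∣≡∣V∣ v v∈V = begin
      degree G X v   ≡⟨ ∑-≤⇒≗ (twice-𝟙≤degree min-degree) ∑degree≤∑twice-𝟙 v ⟩
      twice-𝟙 v      ≡⟨ cong₂ _+_ (𝟙-yes (v ∈? V) (∈VSet⁺ v∈V)) (𝟙-yes (v ∈? V) (∈VSet⁺ v∈V)) ⟩
      2              ∎
      where
      open ≡-Reasoning
      ∑degree≤∑twice-𝟙 : ∑ (degree G X) ≤ ∑ twice-𝟙
      ∑degree≤∑twice-𝟙 = ≤-reflexive (trans (handshake X) (trans (cong₂ _+_ ∣X∣≡∣V∣ ∣X∣≡∣V∣) (∣p∣+∣q∣≡∑𝟙 V V)))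

  component-of-2-regular : ∀ {X D} → (∀ v → InV G X v → degree G X v ≡ 2) → IsComponentOf G X D → IsCycle G D
  component-of-2-regular 2-regular (D⊆X , D-nonempty , D-connected , separated) =
    D-nonempty , D-connected , λ x x∈VD@(f , f∈D , f-at-x) → trans
      (degree-agree D⊆X λ g∈X g∉D g-at-x → separated f _ f∈D g∈X g∉D x f-at-x g-at-x)
      (2-regular x (InV-mono D⊆X x∈VD))

module WeakFrameworkProperties {n m} {G : Graph n m} {M : Matroid m} (framework : IsWeakFramework G M) where
  open Matroid M
  open IsWeakFramework framework
  open GraphProperties G
  open MatroidProperties M

  ∉closure[avoiding] : ∀ {t e} → Incident G t e → ¬ IsLoopAt G t e → ¬ InClosure M (edgesAvoiding G t) e
  ∉closure[avoiding] incident non-loop e∈cl =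
    [ (λ e-avoids-t → ∈edgesAvoiding⁻ e-avoids-t incident) , non-loop ] (vertex-closure _ _ e∈cl)

  edgesWithin : Subset n → Subset m
  edgesWithin U = select (λ e → end₁ G e ∈? U ×-dec end₂ G e ∈? U)

  -- Peel off one component R of G[U], which axiom (2) bounds, and recurse on U ∖ R.
  rank-edgesWithin-closed : ∀ U → Acc (_<_ on ∣_∣) U → Closed allEdges U → rank (edgesWithin U) ≤ ∣ U ∣
  rank-edgesWithin-closed U (acc smaller) U-closed with nonempty? U
  ... | no U≡∅ = ≤-trans (rank-≤-card _) (≤-trans (p⊆q⇒∣p∣≤∣q∣ E⊆⊥) (≤-trans (≤-reflexive (∣⊥∣≡0 m)) z≤n))
    where
    E⊆⊥ : edgesWithin U ⊆ ⊥
    E⊆⊥ e∈E = contradiction (_ , proj₁ (∈-select⁻ _ e∈E)) U≡∅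
  ... | yes (u , u∈U) = begin
    rank (edgesWithin U)                                ≤⟨ rank-mono E⊆ER∪E′ ⟩
    rank (componentEdges G R ∪ edgesWithin U′)          ≤⟨ rank-subadditive _ _ ⟩
    rank (componentEdges G R) + rank (edgesWithin U′)   ≤⟨ +-mono-≤ (component-rank R (reachClosure-isComponent reach)) IH ⟩
    ∣ R ∣ + ∣ U′ ∣                                      ≤⟨ ∣p∣+∣q∣≤∣r∣ R⊆U (proj₁ U′⊂U) R-disjoint-U′ ⟩
    ∣ U ∣                                               ∎
    where
    open ≤-Reasoning
    reach : ReachClosure allEdges u
    reach = reachClosure allEdges u
    open ReachClosure reach renaming (reached to R)
    R⊆U : R ⊆ U
    R⊆U x∈R = walk-stays U-closed u∈U (walk-to x∈R)
    U′ : Subset n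
    U′ = select (λ x → x ∈? U ×-dec ¬? (x ∈? R))
    U′⊂U : U′ ⊂ U
    U′⊂U = proj₁ ∘ ∈-select⁻ _ , u , u∈U , λ u∈U′ → proj₂ (∈-select⁻ _ u∈U′) start∈
    R-disjoint-U′ : ∀ {x} → x ∈ R → x ∉ U′
    R-disjoint-U′ x∈R x∈U′ = proj₂ (∈-select⁻ _ x∈U′) x∈R
    U′-closed : Closed allEdges U′
    U′-closed e∈ joins x∈U′ with ∈-select⁻ _ x∈U′
    ... | x∈U , x∉R = ∈-select⁺ _ (U-closed e∈ joins x∈U , λ y∈R → x∉R (closed e∈ (Joins-sym joins) y∈R))
    IH : rank (edgesWithin U′) ≤ ∣ U′ ∣
    IH = rank-edgesWithin-closed U′ (smaller (p⊂q⇒∣p∣<∣q∣ U′⊂U)) U′-closed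
    E⊆ER∪E′ : edgesWithin U ⊆ componentEdges G R ∪ edgesWithin U′
    E⊆ER∪E′ {e} e∈E with ∈-select⁻ _ e∈E | end₁ G e ∈? R
    ... | _ | yes e₁∈R = p⊆p∪q _ (∈-tabulate⁺ _ (fromWitness e₁∈R))
    ... | e₁∈U , e₂∈U | no e₁∉R = q⊆p∪q _ _ (∈-select⁺ _
          ( ∈-select⁺ _ (e₁∈U , e₁∉R)
          , ∈-select⁺ _ (e₂∈U , λ e₂∈R → e₁∉R (closed (∈-tabulate⁺ _ _) (inj₂ (refl , refl)) e₂∈R))))

  -- Add a crossing edge e = xt with t ∉ U; axiom (3) at t makes e raise the rank of edgesWithin U.
  rank-edgesWithin : ∀ U → Acc _⊃ᶜ_ U → rank (edgesWithin U) ≤ ∣ U ∣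
  rank-edgesWithin U (acc larger) with closed-or-crossing allEdges U
  ... | inj₁ U-closed = rank-edgesWithin-closed U (On.wellFounded ∣_∣ <-wellFounded U) U-closed
  ... | inj₂ (e , x , t , _ , joins , x∈U , t∉U) = +-cancelʳ-≤ 1 _ _ (begin
    rank (edgesWithin U) + 1              ≡⟨ +-comm _ 1 ⟩
    suc (rank (edgesWithin U))            ≤⟨ ∉closure⇒rank-increases e∉cl ⟩
    rank (edgesWithin U ∪ ⁅ e ⁆)          ≤⟨ rank-mono E∪e⊆E′ ⟩
    rank (edgesWithin (U ∪ ⁅ t ⁆))        ≤⟨ rank-edgesWithin (U ∪ ⁅ t ⁆) (larger (p∪⁅x⁆⊃ᶜp t∉U)) ⟩
    ∣ U ∪ ⁅ t ⁆ ∣                         ≤⟨ ∣p∪q∣≤∣p∣+∣q∣ U ⁅ t ⁆ ⟩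
    ∣ U ∣ + ∣ ⁅ t ⁆ ∣                     ≡⟨ cong (∣ U ∣ +_) (∣⁅x⁆∣≡1 t) ⟩
    ∣ U ∣ + 1                             ∎)
    where
    open ≤-Reasoning
    E⊆avoiding : edgesWithin U ⊆ edgesAvoiding G t
    E⊆avoiding f∈E = ∈edgesAvoiding⁺ λ
      { (inj₁ refl) → t∉U (proj₁ (∈-select⁻ _ f∈E))
      ; (inj₂ refl) → t∉U (proj₂ (∈-select⁻ _ f∈E)) }
    e∉cl : ¬ InClosure M (edgesWithin U) e
    e∉cl = ∉closure[avoiding] (Joins⇒Incident (Joins-sym joins)) (λ loop → t∉U (subst (_∈ U) (Joins-loop joins loop) x∈U))
         ∘ InClosure-mono E⊆avoiding
    E∪e⊆E′ : edgesWithin U ∪ ⁅ e ⁆ ⊆ edgesWithin (U ∪ ⁅ t ⁆)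
    E∪e⊆E′ f∈ with x∈p∪q⁻ (edgesWithin U) ⁅ e ⁆ f∈
    ... | inj₁ f∈E = ∈-select⁺ _ (Product.map (p⊆p∪q _) (p⊆p∪q _) (∈-select⁻ _ f∈E))
    ... | inj₂ f∈⁅e⁆ rewrite x∈⁅y⁆⇒x≡y e f∈⁅e⁆ =
      ∈-select⁺ _ (Joins⇒ends∈ joins (p⊆p∪q _ x∈U) (q⊆p∪q U _ (x∈⁅x⁆ t)))

  rank≤∣VSet∣ : ∀ X → rank X ≤ ∣ VSet G X ∣
  rank≤∣VSet∣ X = ≤-trans (rank-mono X⊆E) (rank-edgesWithin (VSet G X) (⊃ᶜ-wellFounded _))
    where
    X⊆E : X ⊆ edgesWithin (VSet G X)
    X⊆E e∈X = ∈-select⁺ _ (∈VSet⁺ (_ , e∈X , inj₁ refl) , ∈VSet⁺ (_ , e∈X , inj₂ refl))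

module CircuitProperties {n m} {G : Graph n m} {M : Matroid m} (framework : IsWeakFramework G M)
                         {C : Subset m} (circuit : IsCircuit M C) where
  open Matroid M
  open GraphProperties G
  open MatroidProperties M
  open WeakFrameworkProperties framework

  private
    V : Subset n
    V = VSet G C

  circuit-min-degree : ∀ v → InV G C v → 2 ≤ degree G C v
  circuit-min-degree v (e , e∈C , incident) with 2 ≤? degree G C v
  ... | yes 2≤d = 2≤d
  ... | no  2≰d = ⊥-elim (∉closure[avoiding] incident non-loop
                            (InClosure-mono C-e⊆avoiding (circuit-element∈closure circuit e∈C)))
    where
    non-loop : ¬ IsLoopAt G v e
    non-loop loop = 2≰d (loop⇒2≤degree e∈C loop)
    C-e⊆avoiding : C - e ⊆ edgesAvoiding G v
    C-e⊆avoiding f∈C-e = ∈edgesAvoiding⁺ λ f-incident →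
      2≰d (two-incident⇒2≤degree e∈C (p─q⊆p C _ f∈C-e) (≢-sym (x∈p-y⇒x≢y f∈C-e)) incident f-incident)

  ∣VSet∣≤∣C∣ : ∣ V ∣ ≤ ∣ C ∣
  ∣VSet∣≤∣C∣ = ∣VSet∣≤∣X∣ C circuit-min-degree

  fewer-vertices⇒tight : ∣ V ∣ < ∣ C ∣ → ∣ C ∣ ≡ ∣ V ∣ + 1
  fewer-vertices⇒tight ∣V∣<∣C∣ =
    trans (≤-antisym (≤-trans (∣C∣≤1+rank[C] circuit) (s≤s (rank≤∣VSet∣ C))) ∣V∣<∣C∣) (+-comm 1 _)

  proper⇒∣D∣≤∣VSet∣ : ∀ {D} → D ⊂ C → ∣ D ∣ ≤ ∣ VSet G D ∣
  proper⇒∣D∣≤∣VSet∣ {D} D⊂C = subst (_≤ ∣ VSet G D ∣) (proj₂ circuit D D⊂C) (rank≤∣VSet∣ D)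

  -- A closed vertex set R meeting V(C) but not containing it splits C into two proper,
  -- hence independent, parts with disjoint vertex sets.
  split⇒∣C∣≤∣VSet∣ : ∀ {R a b} → Closed C R → InV G C a → a ∈ R → InV G C b → b ∉ R → ∣ C ∣ ≤ ∣ V ∣
  split⇒∣C∣≤∣VSet∣ {R} R-closed (e , e∈C , e-at-a) a∈R (f , f∈C , f-at-b) b∉R = begin
    ∣ C ∣                               ≤⟨ p⊆q⇒∣p∣≤∣q∣ C⊆D∪D′ ⟩
    ∣ D ∪ D′ ∣                          ≤⟨ ∣p∪q∣≤∣p∣+∣q∣ D D′ ⟩
    ∣ D ∣ + ∣ D′ ∣                      ≤⟨ +-mono-≤ (proper⇒∣D∣≤∣VSet∣ D⊂C) (proper⇒∣D∣≤∣VSet∣ D′⊂C) ⟩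
    ∣ VSet G D ∣ + ∣ VSet G D′ ∣        ≤⟨ ∣p∣+∣q∣≤∣r∣ (VSet-mono (proj₁ D⊂C)) (VSet-mono (proj₁ D′⊂C)) VD-disjoint-VD′ ⟩
    ∣ V ∣                               ∎
    where
    open ≤-Reasoning
    D D′ : Subset m
    D  = select (λ g → g ∈? C ×-dec end₁ G g ∈? R)
    D′ = select (λ g → g ∈? C ×-dec ¬? (end₁ G g ∈? R))
    C⊆D∪D′ : C ⊆ D ∪ D′
    C⊆D∪D′ {g} g∈C with end₁ G g ∈? R
    ... | yes g₁∈R = p⊆p∪q D′ (∈-select⁺ _ (g∈C , g₁∈R))
    ... | no  g₁∉R = q⊆p∪q D D′ (∈-select⁺ _ (g∈C , g₁∉R))
    D⊂C : D ⊂ C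
    D⊂C = proj₁ ∘ ∈-select⁻ _ , f , f∈C , λ f∈D → b∉R (end₁∈closed⁻ R-closed f∈C f-at-b (proj₂ (∈-select⁻ _ f∈D)))
    D′⊂C : D′ ⊂ C
    D′⊂C = proj₁ ∘ ∈-select⁻ _ , e , e∈C , λ e∈D′ → proj₂ (∈-select⁻ _ e∈D′) (end₁∈closed R-closed e∈C e-at-a a∈R)
    VSet-mono : ∀ {X} → X ⊆ C → VSet G X ⊆ V
    VSet-mono X⊆C = ∈VSet⁺ ∘ InV-mono X⊆C ∘ ∈VSet⁻
    VD-disjoint-VD′ : ∀ {v} → v ∈ VSet G D → v ∉ VSet G D′
    VD-disjoint-VD′ v∈VD v∈VD′ with ∈VSet⁻ v∈VD | ∈VSet⁻ v∈VD′
    ... | g , g∈D , g-at-v | h , h∈D′ , h-at-v with ∈-select⁻ _ g∈D | ∈-select⁻ _ h∈D′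
    ...   | g∈C , g₁∈R | h∈C , h₁∉R =
      h₁∉R (end₁∈closed R-closed h∈C h-at-v (end₁∈closed⁻ R-closed g∈C g-at-v g₁∈R))

  tight⇒connected : ∣ C ∣ ≡ ∣ V ∣ + 1 → Connected G C
  tight⇒connected tight a b a∈V b∈V = walk-or-split (b ∈? reached)
    where
    open ReachClosure (reachClosure C a)
    walk-or-split : Dec (b ∈ reached) → Walk G C a b
    walk-or-split (yes b∈R) = walk-to b∈R
    walk-or-split (no  b∉R) = ⊥-elim (<⇒≱ (≤-reflexive (trans (+-comm 1 _) (sym tight)))
                                         (split⇒∣C∣≤∣VSet∣ closed a∈V start∈ b∈V b∉R))

  tight⇒no-balanced-cycle : ∣ C ∣ ≡ ∣ V ∣ + 1 → ¬ (∃ λ D → D ⊆ C × IsBalancedCycle G M D)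
  tight⇒no-balanced-cycle tight (D , D⊆C , (_ , _ , D-2-regular) , D-circuit)
    with ⊆-antisym D⊆C (dependent-⊆-circuit⇒⊇ circuit D⊆C (proj₁ D-circuit))
  ... | refl = m+1+n≢m ∣ V ∣ (trans (sym tight) (2-regular⇒∣X∣≡∣VSet∣ C D-2-regular))

  loose⇒2-regular : ∣ C ∣ ≡ ∣ V ∣ → ∀ v → InV G C v → degree G C v ≡ 2
  loose⇒2-regular = ∣X∣≡∣VSet∣⇒2-regular C circuit-min-degree

  loose⇒balanced⊎unbalanced-cycles : ∣ C ∣ ≡ ∣ V ∣
    → IsBalancedCycle G M C ⊎ (∀ D → IsComponentOf G C D → IsCycle G D × ¬ IsCircuit M D)
  loose⇒balanced⊎unbalanced-cycles loose = map
    (λ connected → (circuit-nonempty circuit , connected , loose⇒2-regular loose) , circuit)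
    (λ proper D D-component@(D⊆C , _) →
      component-of-2-regular (loose⇒2-regular loose) D-component ,
      proper D D-component ∘ dependent-⊆-circuit⇒⊇ circuit D⊆C ∘ proj₁)
    (connected⊎proper-components (circuit-nonempty circuit))

lemma3p3 : {n m : ℕ} (G : Graph n m) (M : Matroid m) → IsWeakFramework G M
    → (C : Subset m) → IsCircuit M C
    → IsBalancedCycle G M C
      ⊎ (Connected G C
         × (∀ v → InV G C v → 2 ≤ degree G C v)
         × ∣ C ∣ ≡ ∣ VSet G C ∣ + 1
         × ¬ (∃ λ D → D ⊆ C × IsBalancedCycle G M D))
      ⊎ (∀ D → IsComponentOf G C D → IsCycle G D × ¬ IsCircuit M D)
lemma3p3 G M framework C circuit =
  [ (λ ∣V∣<∣C∣ → let tight = fewer-vertices⇒tight ∣V∣<∣C∣ in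
      inj₂ (inj₁ (tight⇒connected tight , circuit-min-degree , tight , tight⇒no-balanced-cycle tight)))
  , (λ ∣V∣≡∣C∣ → map₂ inj₂ (loose⇒balanced⊎unbalanced-cycles (sym ∣V∣≡∣C∣)))
  ] (m≤n⇒m<n∨m≡n ∣VSet∣≤∣C∣)
  where open CircuitProperties framework circuit
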